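{- Assume the setting below with $\mu$ natural. Then for every object $X$, $\alpha\in Q(X)$ and $\beta\in Q(X^{*})$, $$\langle\alpha,\beta\rangle_{X}=\langle\beta,Q(j_X)(\alpha)\rangle_{X^{*}}.$$ Consequently: (1) if $Q(j_X)$ has a right adjoint $Q(j_X)^{*}$, then the element $b:=Q(j_X)^{*}(\omega_{X^*}(\beta))\in Q(X)$ satisfies, for all $\alpha\in Q(X)$, $\alpha\le b\iff\langle\alpha,\beta\rangle_X\le\omega$; (2) if $j_X$ is invertible, then the element $b:=Q(j_X^{ -1})(\omega_{X^*}(\beta))$ satisfies, for all $\alpha\in Q(X)$, $\alpha\le b\iff\langle\alpha,\beta\rangle_X\le\omega$.
   Context: $(\mathsf{C},\otimes,I,a,\lambda,\rho,\sigma)$ is symmetric monoidal closed with internal hom $\multimap$, counit $\mathrm{ev}_{X,Y}:X\otimes(X\multimap Y)\to Y$. $Q:\mathsf{C}\to\mathsf{Pos}$ is a functor with $u\in Q(I)$ and monotone maps $\mu_{X,Y}:Q(X)\times Q(Y)\to Q(X\otimes Y)$ that are natural ($Q(f\otimes g)\circ\mu_{X,Y}=\mu_{X',Y'}\circ(Q(f)\times Q(g))$) and satisfy $Q(\lambda_Y)(\mu_{I,Y}(u,y))=y$, $Q(\rho_X)(\mu_{X,I}(x,u))=x$, $Q(a)(\mu(\mu(x,y),z))=\mu(x,\mu(y,z))$, $Q(\sigma_{X,Y})(\mu_{X,Y}(x,y))=\mu_{Y,X}(y,x)$. Put $\langle x,b\rangle_{X,Y}:=Q(\mathrm{ev}_{X,Y})(\mu_{X,X\multimap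 Y}(x,b))$ and assume each $\langle\alpha,-\rangle_{X,Y}$ has a right adjoint $\iota_{X,Y}(\alpha,-)$. Fix an object $0$ and $\omega\in Q(0)$; $X^*:=X\multimap0$, $\langle\alpha,\beta\rangle_X:=\langle\alpha,\beta\rangle_{X,0}$, $\omega_X(\alpha):=\iota_{X,0}(\alpha,\omega)$; $j_X:X\to X^{**}$ is the canonical arrow, transpose of $\mathrm{ev}_{X,0}\circ\sigma_{X^*,X}:X^*\otimes X\to0$. -}

module Defs where

open import Level using (Level; _⊔_) renaming (suc to lsuc)
open import Relation.Binary.PropositionalEquality using (_≡_)
open import Relation.Binary.Bundles using (Poset)
open import Function.Bundles using (_⇔_)

record SMCC (o h : Level) : Set (lsuc (o ⊔ h)) where
  infixr 9 _∘_
  infixr 10 _⊗₀_ _⊗₁_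
  infixr 8 _⊸_
  field
    Obj : Set o
    _⇒_ : Obj → Obj → Set h
    id  : ∀ {A} → A ⇒ A
    _∘_ : ∀ {A B C} → B ⇒ C → A ⇒ B → A ⇒ C
    identityˡ : ∀ {A B} (f : A ⇒ B) → id ∘ f ≡ f
    identityʳ : ∀ {A B} (f : A ⇒ B) → f ∘ id ≡ f
    assoc : ∀ {A B C D} (h : C ⇒ D) (g : B ⇒ C) (f : A ⇒ B) →
            (h ∘ g) ∘ f ≡ h ∘ (g ∘ f)
    _⊗₀_ : Obj → Obj → Obj
    _⊗₁_ : ∀ {A B C D} → A ⇒ B → C ⇒ D → (A ⊗₀ C) ⇒ (B ⊗₀ D)
    ⊗-id : ∀ {A C} → id {A} ⊗₁ id {C} ≡ id
    ⊗-∘  : ∀ {A B E C D F} (f : A ⇒ B) (g : B ⇒ E) (h : C ⇒ D) (k : D ⇒ F) →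
           (g ∘ f) ⊗₁ (k ∘ h) ≡ (g ⊗₁ k) ∘ (f ⊗₁ h)
    I : Obj
    a    : ∀ {X Y Z} → ((X ⊗₀ Y) ⊗₀ Z) ⇒ (X ⊗₀ (Y ⊗₀ Z))
    a⁻¹  : ∀ {X Y Z} → (X ⊗₀ (Y ⊗₀ Z)) ⇒ ((X ⊗₀ Y) ⊗₀ Z)
    a-isoˡ : ∀ {X Y Z} → a⁻¹ ∘ a {X} {Y} {Z} ≡ id
    a-isoʳ : ∀ {X Y Z} → a {X} {Y} {Z} ∘ a⁻¹ ≡ id
    a-natural : ∀ {X X' Y Y' Z Z'} (f : X ⇒ X') (g : Y ⇒ Y') (k : Z ⇒ Z') →
                a ∘ ((f ⊗₁ g) ⊗₁ k) ≡ (f ⊗₁ (g ⊗₁ k)) ∘ a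
    lam   : ∀ {Y} → (I ⊗₀ Y) ⇒ Y
    lam⁻¹ : ∀ {Y} → Y ⇒ (I ⊗₀ Y)
    lam-isoˡ : ∀ {Y} → lam⁻¹ ∘ lam {Y} ≡ id
    lam-isoʳ : ∀ {Y} → lam {Y} ∘ lam⁻¹ ≡ id
    lam-natural : ∀ {Y Y'} (f : Y ⇒ Y') → lam ∘ (id ⊗₁ f) ≡ f ∘ lam
    rho   : ∀ {X} → (X ⊗₀ I) ⇒ X
    rho⁻¹ : ∀ {X} → X ⇒ (X ⊗₀ I)
    rho-isoˡ : ∀ {X} → rho⁻¹ ∘ rho {X} ≡ id
    rho-isoʳ : ∀ {X} → rho {X} ∘ rho⁻¹ ≡ id
    rho-natural : ∀ {X X'} (f : X ⇒ X') → rho ∘ (f ⊗₁ id) ≡ f ∘ rho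
    σ : ∀ {X Y} → (X ⊗₀ Y) ⇒ (Y ⊗₀ X)
    σ-involutive : ∀ {X Y} → σ {Y} {X} ∘ σ {X} {Y} ≡ id
    σ-natural : ∀ {X X' Y Y'} (f : X ⇒ X') (g : Y ⇒ Y') →
                σ ∘ (f ⊗₁ g) ≡ (g ⊗₁ f) ∘ σ
    pentagon : ∀ {W X Y Z} →
      (id {W} ⊗₁ a {X} {Y} {Z}) ∘ a ∘ (a ⊗₁ id) ≡ a ∘ a
    triangle : ∀ {X Y} → (id {X} ⊗₁ lam {Y}) ∘ a ≡ rho ⊗₁ id
    hexagon : ∀ {X Y Z} →
      a {Y} {Z} {X} ∘ σ ∘ a ≡ (id ⊗₁ σ) ∘ a ∘ (σ ⊗₁ id {Z})
    _⊸_ : Obj → Obj → Obj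
    ev : ∀ {X Y} → (X ⊗₀ (X ⊸ Y)) ⇒ Y
    curry : ∀ {A B C} → (A ⊗₀ B) ⇒ C → B ⇒ (A ⊸ C)
    ev-curry : ∀ {A B C} (f : (A ⊗₀ B) ⇒ C) → ev ∘ (id ⊗₁ curry f) ≡ f
    curry-unique : ∀ {A B C} (f : (A ⊗₀ B) ⇒ C) (g : B ⇒ (A ⊸ C)) →
                   ev ∘ (id ⊗₁ g) ≡ f → g ≡ curry f

record Setting {o h : Level} (C : SMCC o h) (q₁ q₂ q₃ : Level)
       : Set (o ⊔ h ⊔ lsuc (q₁ ⊔ q₂ ⊔ q₃)) where
  open SMCC C
  field
    Q : Obj → Poset q₁ q₂ q₃

  ∣_∣ : Obj → Set q₁
  ∣ X ∣ = Poset.Carrier (Q X)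

  _≈[_]_ : ∀ {X} → ∣ X ∣ → (Y : Obj) → ∣ X ∣ → Set q₂
  x ≈[ _ ] y = Poset._≈_ (Q _) x y

  _≤[_]_ : ∀ {X} → ∣ X ∣ → (Y : Obj) → ∣ X ∣ → Set q₃
  x ≤[ _ ] y = Poset._≤_ (Q _) x y

  field
    Q₁ : ∀ {A B} → A ⇒ B → ∣ A ∣ → ∣ B ∣
    Q₁-mono : ∀ {A B} (f : A ⇒ B) {x y : ∣ A ∣} →
              Poset._≤_ (Q A) x y → Poset._≤_ (Q B) (Q₁ f x) (Q₁ f y)
    Q-id : ∀ {A} (x : ∣ A ∣) → Poset._≈_ (Q A) (Q₁ id x) x
    Q-∘  : ∀ {A B D} (g : B ⇒ D) (f : A ⇒ B) (x : ∣ A ∣) →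
           Poset._≈_ (Q D) (Q₁ (g ∘ f) x) (Q₁ g (Q₁ f x))
    u : ∣ I ∣
    μ : ∀ {X Y} → ∣ X ∣ → ∣ Y ∣ → ∣ X ⊗₀ Y ∣
    μ-mono : ∀ {X Y} {x x' : ∣ X ∣} {y y' : ∣ Y ∣} →
             Poset._≤_ (Q X) x x' → Poset._≤_ (Q Y) y y' →
             Poset._≤_ (Q (X ⊗₀ Y)) (μ x y) (μ x' y')
    μ-natural : ∀ {X X' Y Y'} (f : X ⇒ X') (g : Y ⇒ Y') (x : ∣ X ∣) (y : ∣ Y ∣) →
                Poset._≈_ (Q (X' ⊗₀ Y')) (Q₁ (f ⊗₁ g) (μ x y)) (μ (Q₁ f x) (Q₁ g y))
    μ-unitˡ : ∀ {Y} (y : ∣ Y ∣) → Poset._≈_ (Q Y) (Q₁ lam (μ u y)) y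
    μ-unitʳ : ∀ {X} (x : ∣ X ∣) → Poset._≈_ (Q X) (Q₁ rho (μ x u)) x
    μ-assoc : ∀ {X Y Z} (x : ∣ X ∣) (y : ∣ Y ∣) (z : ∣ Z ∣) →
              Poset._≈_ (Q (X ⊗₀ (Y ⊗₀ Z))) (Q₁ a (μ (μ x y) z)) (μ x (μ y z))
    μ-sym : ∀ {X Y} (x : ∣ X ∣) (y : ∣ Y ∣) →
            Poset._≈_ (Q (Y ⊗₀ X)) (Q₁ σ (μ x y)) (μ y x)

  pair : ∀ {X Y} → ∣ X ∣ → ∣ X ⊸ Y ∣ → ∣ Y ∣
  pair x b = Q₁ ev (μ x b)

  field
    ι : ∀ {X Y} → ∣ X ∣ → ∣ Y ∣ → ∣ X ⊸ Y ∣
    ι-adj : ∀ {X Y} (α : ∣ X ∣) (b : ∣ X ⊸ Y ∣) (c : ∣ Y ∣) →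
            Poset._≤_ (Q Y) (pair α b) c ⇔ Poset._≤_ (Q (X ⊸ Y)) b (ι α c)

module Dual {o h q₁ q₂ q₃ : Level} {C : SMCC o h} (S : Setting C q₁ q₂ q₃)
            (O : SMCC.Obj C) (ω : Poset.Carrier (Setting.Q S O)) where
  open SMCC C
  open Setting S

  _* : Obj → Obj
  X * = X ⊸ O

  pairX : ∀ {X} → ∣ X ∣ → ∣ X * ∣ → ∣ O ∣
  pairX = pair

  ωX : ∀ {X} → ∣ X ∣ → ∣ X * ∣
  ωX α = ι α ω

  j : ∀ {X} → X ⇒ ((X *) *)
  j {X} = curry (ev {X} {O} ∘ σ {X *} {X})

{-# OPTIONS --safe #-}
module Submission where

-- Pairing against a transpose curry f amounts to applying f to μ, by naturality
-- of μ and the universal property of ev. Since j is the transpose of ev ∘ σ,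
-- pairing β against Q(j) α is ev applied to σ(μ(β, α)) = μ(α, β). For the two
-- consequences, α ≤ R(ω_{X*} β) unfolds through the Galois connections
-- Q(j) ⊣ R and ⟨β, -⟩ ⊣ ι(β, -) to ⟨β, Q(j) α⟩ ≤ ω; an inverse k of j makes
-- Q(k) right adjoint to Q(j).

open import Defs
open import Level using (Level)
open import Relation.Binary.PropositionalEquality using (_≡_; refl)
open import Relation.Binary.Bundles using (Poset)
open import Function.Bundles using (_⇔_; mk⇔)
open import Function.Properties.Equivalence using (⇔-setoid) renaming (sym to ⇔-sym)
open import Data.Product using (_×_; _,_)
import Relation.Binary.Reasoning.Setoid as SetoidReasoning

module SettingProperties {o h q₁ q₂ q₃ : Level} {C : SMCC o h}
                         (S : Setting C q₁ q₂ q₃) where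
  open SMCC C
  open Setting S
  module Q (A : Obj) = Poset (Q A)

  Q₁-cong : ∀ {A B} (f : A ⇒ B) {x y : ∣ A ∣} → x ≈[ A ] y → Q₁ f x ≈[ B ] Q₁ f y
  Q₁-cong {B = B} f x≈y =
    Q.antisym B (Q₁-mono f (Q.reflexive _ x≈y)) (Q₁-mono f (Q.reflexive _ (Q.Eq.sym _ x≈y)))

  Q₁-resp-≡ : ∀ {A B} {f g : A ⇒ B} (x : ∣ A ∣) → f ≡ g → Q₁ f x ≈[ B ] Q₁ g x
  Q₁-resp-≡ {B = B} x refl = Q.Eq.refl B

  μ-cong : ∀ {X Y} {x x' : ∣ X ∣} {y y' : ∣ Y ∣} →
           x ≈[ X ] x' → y ≈[ Y ] y' → μ x y ≈[ X ⊗₀ Y ] μ x' y'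
  μ-cong x≈x' y≈y' =
    Q.antisym _ (μ-mono (Q.reflexive _ x≈x') (Q.reflexive _ y≈y'))
                (μ-mono (Q.reflexive _ (Q.Eq.sym _ x≈x')) (Q.reflexive _ (Q.Eq.sym _ y≈y')))

  ≤-respˡ-≈-⇔ : ∀ {A} {x x' y : ∣ A ∣} → x ≈[ A ] x' → x ≤[ A ] y ⇔ x' ≤[ A ] y
  ≤-respˡ-≈-⇔ x≈x' = mk⇔ (Q.≤-respˡ-≈ _ x≈x') (Q.≤-respˡ-≈ _ (Q.Eq.sym _ x≈x'))

  pair-curry : ∀ {A B D} (f : (A ⊗₀ B) ⇒ D) (x : ∣ A ∣) (y : ∣ B ∣) →
               pair x (Q₁ (curry f) y) ≈[ D ] Q₁ f (μ x y)
  pair-curry {A = A} {D = D} f x y = begin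
    Q₁ ev (μ x (Q₁ (curry f) y))            ≈⟨ Q₁-cong ev (μ-cong (Q.Eq.sym A (Q-id x)) (Q.Eq.refl _)) ⟩
    Q₁ ev (μ (Q₁ id x) (Q₁ (curry f) y))    ≈⟨ Q₁-cong ev (Q.Eq.sym _ (μ-natural id (curry f) x y)) ⟩
    Q₁ ev (Q₁ (id ⊗₁ curry f) (μ x y))      ≈⟨ Q.Eq.sym D (Q-∘ ev (id ⊗₁ curry f) (μ x y)) ⟩
    Q₁ (ev ∘ (id ⊗₁ curry f)) (μ x y)       ≈⟨ Q₁-resp-≡ (μ x y) (ev-curry f) ⟩
    Q₁ f (μ x y)                            ∎
    where open SetoidReasoning (Q.Eq.setoid D)

  Q₁-inverse⇒adjoint : ∀ {A B} (f : A ⇒ B) (g : B ⇒ A) → g ∘ f ≡ id → f ∘ g ≡ id →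
                       ∀ (x : ∣ A ∣) (y : ∣ B ∣) → Q₁ f x ≤[ B ] y ⇔ x ≤[ A ] Q₁ g y
  Q₁-inverse⇒adjoint {A} {B} f g gf≡id fg≡id x y = mk⇔
    (λ fx≤y → Q.≤-respˡ-≈ A gfx≈x (Q₁-mono g fx≤y))
    (λ x≤gy → Q.≤-respʳ-≈ B fgy≈y (Q₁-mono f x≤gy))
    where
    gfx≈x : Q₁ g (Q₁ f x) ≈[ A ] x
    gfx≈x = Q.Eq.trans A (Q.Eq.sym A (Q-∘ g f x)) (Q.Eq.trans A (Q₁-resp-≡ x gf≡id) (Q-id x))
    fgy≈y : Q₁ f (Q₁ g y) ≈[ B ] y
    fgy≈y = Q.Eq.trans B (Q.Eq.sym B (Q-∘ f g y)) (Q.Eq.trans B (Q₁-resp-≡ y fg≡id) (Q-id y))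

module DualProperties {o h q₁ q₂ q₃ : Level} {C : SMCC o h} (S : Setting C q₁ q₂ q₃)
                      (O : SMCC.Obj C) (ω : Setting.∣_∣ S O) where
  open SMCC C
  open Setting S
  open Dual S O ω
  open SettingProperties S

  pairX-swap : ∀ {X} (α : ∣ X ∣) (β : ∣ X * ∣) → pairX α β ≈[ O ] pairX β (Q₁ j α)
  pairX-swap α β = Q.Eq.sym O (begin
    pair β (Q₁ (curry (ev ∘ σ)) α)   ≈⟨ pair-curry (ev ∘ σ) β α ⟩
    Q₁ (ev ∘ σ) (μ β α)              ≈⟨ Q-∘ ev σ (μ β α) ⟩
    Q₁ ev (Q₁ σ (μ β α))             ≈⟨ Q₁-cong ev (μ-sym β α) ⟩
    Q₁ ev (μ α β)                    ∎)
    where open SetoidReasoning (Q.Eq.setoid O)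

  ≤-ωX-⇔ : ∀ {X} (R : ∣ (X *) * ∣ → ∣ X ∣) →
           (∀ x y → Q₁ j x ≤[ (X *) * ] y ⇔ x ≤[ X ] R y) →
           ∀ (β : ∣ X * ∣) (α : ∣ X ∣) → α ≤[ X ] R (ωX β) ⇔ pairX α β ≤[ O ] ω
  ≤-ωX-⇔ {X} R Q₁j⊣R β α = begin
    α ≤[ X ] R (ωX β)              ≈⟨ ⇔-sym (Q₁j⊣R α (ωX β)) ⟩
    Q₁ j α ≤[ (X *) * ] ι β ω      ≈⟨ ⇔-sym (ι-adj β (Q₁ j α) ω) ⟩
    pairX β (Q₁ j α) ≤[ O ] ω      ≈⟨ ≤-respˡ-≈-⇔ (Q.Eq.sym O (pairX-swap α β)) ⟩
    pairX α β ≤[ O ] ω             ∎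
    where open SetoidReasoning (⇔-setoid q₃)

mainTheorem9 : ∀ {o h q₁ q₂ q₃ : Level} (C : SMCC o h) (S : Setting C q₁ q₂ q₃)
  (O : SMCC.Obj C) (ω : Setting.∣_∣ S O) →
  let open SMCC C
      open Setting S
      open Dual S O ω
  in ∀ (X : Obj) (β : ∣ X * ∣) →
     (∀ (α : ∣ X ∣) → Poset._≈_ (Q O) (pairX α β) (pairX β (Q₁ j α)))
     × (∀ (R : ∣ (X *) * ∣ → ∣ X ∣) →
          (∀ (x : ∣ X ∣) (y : ∣ (X *) * ∣) →
             Poset._≤_ (Q ((X *) *)) (Q₁ j x) y ⇔ Poset._≤_ (Q X) x (R y)) →
          ∀ (α : ∣ X ∣) →
          Poset._≤_ (Q X) α (R (ωX β)) ⇔ Poset._≤_ (Q O) (pairX α β) ω)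
     × (∀ (k : ((X *) *) ⇒ X) → k ∘ j ≡ id → j ∘ k ≡ id →
          ∀ (α : ∣ X ∣) →
          Poset._≤_ (Q X) α (Q₁ k (ωX β)) ⇔ Poset._≤_ (Q O) (pairX α β) ω)
mainTheorem9 C S O ω X β =
    (λ α → pairX-swap α β)
  , (λ R Q₁j⊣R → ≤-ωX-⇔ R Q₁j⊣R β)
  , (λ k kj≡id jk≡id → ≤-ωX-⇔ (Q₁ k) (Q₁-inverse⇒adjoint j k kj≡id jk≡id) β)
  where
  open SMCC C
  open Setting S
  open Dual S O ω
  open SettingProperties S
  open DualProperties S O ω
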